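{- Let $T$ be a tree in which every non-leaf vertex has degree at least $4$. Then the pathwidth of $T$ is at most the minimum number of subtrees of maximum degree at most $3$ that cover $E(T)$.
   Context: A covering of a graph is a set of connected subgraphs such that every edge is in at least one subgraph. Pathwidth of trees: $K_1$ has pathwidth $0$; a forest has the maximum pathwidth of its components; a tree $T$ has pathwidth the minimum $k$ such that some path $P$ of $T$ has $T-V(P)$ of pathwidth at most $k-1$. -}

module Defs where

open import Data.Nat using (ℕ; zero; suc; _+_; _≤_)
open import Data.Fin using (Fin; zero; suc)
open import Data.Bool using (Bool; true; false; _∧_; not; if_then_else_)
open import Data.List using (List; []; _∷_; _++_; length)
open import Data.List.Membership.Propositional using (_∈_)
open import Data.List.Relation.Unary.Unique.Propositional using (Unique)
open import Data.Product using (Σ; _×_; ∃)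
open import Data.Sum using (_⊎_)
open import Relation.Binary.PropositionalEquality using (_≡_)
open import Relation.Nullary using (¬_)
open import Relation.Nullary.Decidable using (⌊_⌋)
import Data.List.Membership.DecPropositional as DecMem
import Data.Fin as F

record Graph (n : ℕ) : Set where
  field
    E      : Fin n → Fin n → Bool
    sym    : ∀ u v → E u v ≡ E v u
    irrefl : ∀ v → E v v ≡ false
open Graph public

Subset : ℕ → Set
Subset n = Fin n → Bool

full : ∀ {n} → Subset n
full _ = true

count : ∀ {n} → Subset n → ℕ
count {zero}  f = 0
count {suc n} f = (if f zero then 1 else 0) + count (λ i → f (suc i))

degIn : ∀ {n} → Graph n → Subset n → Fin n → ℕ
degIn G U v = count (λ w → E G v w ∧ U w)

deg : ∀ {n} → Graph n → Fin n → ℕ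
deg G v = degIn G full v

data IsWalk {n} (G : Graph n) (U : Subset n) : List (Fin n) → Set where
  one  : ∀ {v} → U v ≡ true → IsWalk G U (v ∷ [])
  cons : ∀ {v w vs} → U v ≡ true → E G v w ≡ true →
         IsWalk G U (w ∷ vs) → IsWalk G U (v ∷ w ∷ vs)

IsPath : ∀ {n} → Graph n → Subset n → List (Fin n) → Set
IsPath G U ps = IsWalk G U ps × Unique ps

data Reach {n} (G : Graph n) (U : Subset n) : Fin n → Fin n → Set where
  here : ∀ {v} → U v ≡ true → Reach G U v v
  step : ∀ {u w v} → U u ≡ true → E G u w ≡ true → Reach G U w v → Reach G U u v

-- G[U] is connected (nonemptiness required separately where needed)
Connected : ∀ {n} → Graph n → Subset n → Set
Connected G U = ∀ u v → U u ≡ true → U v ≡ true → Reach G U u v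

NonEmpty : ∀ {n} → Subset n → Set
NonEmpty U = ∃ λ v → U v ≡ true

HasCycle : ∀ {n} → Graph n → Set
HasCycle {n} G = Σ (List (Fin n)) λ ps → Σ (Fin n) λ v → Σ (Fin n) λ w →
  IsWalk G full (v ∷ ps ++ w ∷ []) × Unique (v ∷ ps ++ w ∷ []) ×
  1 ≤ length ps × E G w v ≡ true

IsTree : ∀ {n} → Graph n → Set
IsTree {n} G = NonEmpty {n} full × Connected G full × ¬ HasCycle G

-- In a tree G a connected
-- subgraph contains every edge of G between its vertices, so subtrees of a tree
-- are exactly the nonempty vertex sets U with G[U] connected.
IsSubtree : ∀ {n} → Graph n → Subset n → Set
IsSubtree G U = NonEmpty U × Connected G U

MaxDegAtMost : ∀ {n} → ℕ → Graph n → Subset n → Set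
MaxDegAtMost d G U = ∀ v → U v ≡ true → degIn G U v ≤ d

CoversEdges : ∀ {n m} → Graph n → (Fin m → Subset n) → Set
CoversEdges {m = m} G U = ∀ u v → E G u v ≡ true →
  Σ (Fin m) λ i → U i u ≡ true × U i v ≡ true

IsComponent : ∀ {n} → Graph n → Subset n → Subset n → Set
IsComponent G S C =
  (∀ v → C v ≡ true → S v ≡ true) × NonEmpty C × Connected G C ×
  (∀ u w → C u ≡ true → S w ≡ true → E G u w ≡ true → C w ≡ true)

IsSingleton : ∀ {n} → Subset n → Set
IsSingleton U = ∃ λ v → ∀ u → U u ≡ true → u ≡ v

minusList : ∀ {n} → Subset n → List (Fin n) → Subset n
minusList {n} U ps v = U v ∧ not ⌊ DecMem._∈?_ (F._≟_ {n}) v ps ⌋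

-- TreePW≤ G k C : "the tree G[C] has pathwidth at most k", following the
-- recursive definition: K1 has pathwidth 0; a forest has the maximum
-- pathwidth of its components; a tree T has pathwidth the least k such that
-- some path P of T has T - V(P) of pathwidth at most k-1.
TreePW≤ : ∀ {n} → Graph n → ℕ → Subset n → Set
TreePW≤ G zero    C = IsSingleton C
TreePW≤ {n} G (suc k) C = IsSingleton C ⊎
  Σ (List (Fin n)) λ ps → IsPath G C ps ×
    (∀ D → IsComponent G (minusList C ps) D → TreePW≤ G k D)

ForestPW≤ : ∀ {n} → Graph n → ℕ → Subset n → Set
ForestPW≤ G k S = ∀ D → IsComponent G S D → TreePW≤ G k D

Pathwidth≤ : ∀ {n} → Graph n → ℕ → Set
Pathwidth≤ G k = TreePW≤ G k full

module Submission where

-- We show by induction on k that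
-- T[D] has pathwidth at most k whenever at most k members meet D; for D = T this is the
-- theorem.  If no member meets D then D has no edge and is a single vertex.  Otherwise it
-- suffices to find a path P in D such that every component of D − P misses some member
-- meeting D (a "good path"):
--  * if two members meeting D are disjoint, take a path of D joining them; a component
--    meeting both would force both to contain the vertex where it attaches to P;
--  * otherwise, by the Helly property of subtrees, the core of D (the vertices of D in
--    every member meeting D) is nonempty; take a maximal path of the core.  A component
--    meeting every member attaches to P at some x by an edge xy with y in the core, so x
--    is an inner vertex of P, and its two path neighbours, y and a fourth neighbour
--    (x has degree at least 4) all lie in the member covering the fourth edge.

open import Defs
open import Data.Nat using (ℕ; zero; suc; _+_; _≤_; _<_; z≤n; s≤s)
open import Data.Nat.Properties using (≤-refl; ≤-trans; m≤n⇒m≤1+n; <⇒≱; +-suc; +-assoc; +-identityʳ; ≤-pred)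
open import Data.Fin using (Fin; zero; suc)
import Data.Fin as F
open import Data.Fin.Properties using (any?; all?)
open import Data.Bool using (Bool; true; false; _∧_; not; if_then_else_)
open import Data.Bool.Properties using (∧-identityʳ)
import Data.Bool as B
open import Data.List using (List; []; _∷_; _++_; length; map; filter; allFin)
open import Data.List.Membership.Propositional.Properties using (∈-map⁺; ∈-map⁻; ∈-filter⁺; ∈-filter⁻; ∈-allFin)
open import Data.List.Properties using (length-++)
open import Data.List.Membership.Propositional using (_∈_; _∉_; find)
import Data.List.Membership.DecPropositional as DecMem
open import Data.List.Relation.Unary.Any using (here; there)
open import Data.List.Relation.Unary.All using ([]; _∷_)
import Data.List.Relation.Unary.All as All
open import Data.List.Relation.Unary.All.Properties using (¬Any⇒All¬; ¬All⇒Any¬)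
open import Data.List.Relation.Unary.Unique.Propositional using (Unique)
open import Data.List.Relation.Unary.AllPairs using ([]; _∷_)
import Data.List.Relation.Unary.Unique.Propositional.Properties as Unique
open import Data.Product using (Σ; _×_; ∃; _,_; proj₁; proj₂)
open import Data.Sum using (_⊎_; inj₁; inj₂)
open import Data.Empty using (⊥; ⊥-elim)
open import Function using (case_of_)
open import Relation.Binary.PropositionalEquality using (_≡_; _≢_; refl; trans; cong; subst; module ≡-Reasoning)
  renaming (sym to ≡-sym)
open import Relation.Nullary using (¬_; Dec; yes; no)
open import Relation.Nullary.Decidable using (⌊_⌋; ¬?; _×-dec_; _→-dec_)

∧-elim : ∀ {a b} → a ∧ b ≡ true → a ≡ true × b ≡ true
∧-elim {true} p = refl , p

∧-intro : ∀ {a b} → a ≡ true → b ≡ true → a ∧ b ≡ true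
∧-intro refl refl = refl

true≠false : ∀ {b} → b ≡ true → b ≡ false → ⊥
true≠false refl ()

not-true : ∀ {b} → not b ≡ true → b ≢ true
not-true {false} _ ()

not-intro : ∀ {b} → b ≢ true → not b ≡ true
not-intro {true} b≢true = ⊥-elim (b≢true refl)
not-intro {false} _ = refl

⌊⌋-elim : ∀ {P : Set} (p? : Dec P) → ⌊ p? ⌋ ≡ true → P
⌊⌋-elim (yes p) _ = p

⌊⌋-intro : ∀ {P : Set} (p? : Dec P) → P → ⌊ p? ⌋ ≡ true
⌊⌋-intro (yes _) _ = refl
⌊⌋-intro (no ¬p) p = ⊥-elim (¬p p)

not⌊⌋-elim : ∀ {P : Set} (p? : Dec P) → not ⌊ p? ⌋ ≡ true → ¬ P
not⌊⌋-elim (no ¬p) _ = ¬p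

not⌊⌋-intro : ∀ {P : Set} (p? : Dec P) → ¬ P → not ⌊ p? ⌋ ≡ true
not⌊⌋-intro (yes p) ¬p = ⊥-elim (¬p p)
not⌊⌋-intro (no _) _ = refl

_⊆_ : ∀ {n} → Subset n → Subset n → Set
A ⊆ B = ∀ v → A v ≡ true → B v ≡ true

allBut : ∀ {n} → Fin n → Subset n
allBut y v = not ⌊ v F.≟ y ⌋

allBut-intro : ∀ {n} {y v : Fin n} → v ≢ y → allBut y v ≡ true
allBut-intro {y = y} {v} v≢y = not⌊⌋-intro (v F.≟ y) v≢y

allBut-elim : ∀ {n} {y v : Fin n} → allBut y v ≡ true → v ≢ y
allBut-elim {y = y} {v} = not⌊⌋-elim (v F.≟ y)

_∈?_ : ∀ {n} (v : Fin n) (L : List (Fin n)) → Dec (v ∈ L)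
_∈?_ {n} = DecMem._∈?_ (F._≟_ {n})

minusList-elim : ∀ {n} {D : Subset n} {L v} → minusList D L v ≡ true → D v ≡ true × v ∉ L
minusList-elim {D = D} {L} {v} p = let (dv , nv) = ∧-elim {D v} p in dv , not⌊⌋-elim (v ∈? L) nv

minusList-intro : ∀ {n} {D : Subset n} {L v} → D v ≡ true → v ∉ L → minusList D L v ≡ true
minusList-intro {D = D} {L} {v} dv v∉L = ∧-intro dv (not⌊⌋-intro (v ∈? L) v∉L)

Meets : ∀ {n} → Subset n → Subset n → Set
Meets A B = ∃ λ v → A v ≡ true × B v ≡ true

meets? : ∀ {n} (A B : Subset n) → Dec (Meets A B)
meets? A B = any? (λ v → (A v B.≟ true) ×-dec (B v B.≟ true))

complement : ∀ {n} → Subset n → Subset n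
complement X v = not (X v)

⋂ : ∀ {n} → List (Subset n) → Subset n
⋂ Cs v = ⌊ All.all? (λ C → C v B.≟ true) Cs ⌋

⋂-elim : ∀ {n} {Cs : List (Subset n)} {C v} → ⋂ Cs v ≡ true → C ∈ Cs → C v ≡ true
⋂-elim {Cs = Cs} {v = v} p = All.lookup (⌊⌋-elim (All.all? (λ C → C v B.≟ true) Cs) p)

⋂-intro : ∀ {n} {Cs : List (Subset n)} {v} → (∀ C → C ∈ Cs → C v ≡ true) → ⋂ Cs v ≡ true
⋂-intro {Cs = Cs} {v} all = ⌊⌋-intro (All.all? (λ C → C v B.≟ true) Cs) (All.tabulate (all _))

⋂-missing : ∀ {n} {Cs : List (Subset n)} {v} → ⋂ Cs v ≢ true → ∃ λ C → C ∈ Cs × C v ≢ true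
⋂-missing {Cs = Cs} {v} v∉⋂ =
  find (¬All⇒Any¬ (λ C → C v B.≟ true) Cs (λ all → v∉⋂ (⌊⌋-intro (All.all? (λ C → C v B.≟ true) Cs) all)))

count-ext : ∀ {k} {f g : Subset k} → (∀ i → f i ≡ g i) → count f ≡ count g
count-ext {zero} _ = refl
count-ext {suc k} {f} {g} f≗g rewrite f≗g zero = cong (_ +_) (count-ext (λ i → f≗g (suc i)))

count-≤ : ∀ {k} (f : Subset k) → count f ≤ k
count-≤ {zero} f = z≤n
count-≤ {suc k} f with f zero
... | true = s≤s (count-≤ _)
... | false = m≤n⇒m≤1+n (count-≤ _)

count-mono : ∀ {k} {f g : Subset k} → f ⊆ g → count f ≤ count g
count-mono {zero} _ = z≤n
count-mono {suc k} {f} {g} f⊆g with f zero in fz | g zero in gz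
... | true | true = s≤s (count-mono (λ i → f⊆g (suc i)))
... | true | false = ⊥-elim (true≠false (f⊆g zero fz) gz)
... | false | true = m≤n⇒m≤1+n (count-mono (λ i → f⊆g (suc i)))
... | false | false = count-mono (λ i → f⊆g (suc i))

removeOne : ∀ {k} → Subset k → Fin k → Subset k
removeOne f a v = f v ∧ allBut a v

removeOne-suc : ∀ {k} (f : Subset (suc k)) a i →
  removeOne (λ j → f (suc j)) a i ≡ removeOne f (suc a) (suc i)
removeOne-suc f a i with i F.≟ a
... | yes _ = refl
... | no _ = refl

count-removeOne : ∀ {k} (f : Subset k) a → f a ≡ true → count f ≡ suc (count (removeOne f a))
count-removeOne {suc k} f zero fa rewrite fa =
  cong suc (count-ext (λ i → ≡-sym (∧-identityʳ (f (suc i)))))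
count-removeOne {suc k} f (suc a) fa rewrite ∧-identityʳ (f zero) = begin
  first + count (λ i → f (suc i))                           ≡⟨ cong (first +_) (count-removeOne _ a fa) ⟩
  first + suc (count (removeOne (λ i → f (suc i)) a))      ≡⟨ cong (λ c → first + suc c)
                                                                  (count-ext (removeOne-suc f a)) ⟩
  first + suc (count (λ i → removeOne f (suc a) (suc i)))  ≡⟨ +-suc first _ ⟩
  suc (first + count (λ i → removeOne f (suc a) (suc i)))  ∎
  where
  open ≡-Reasoning
  first : ℕ
  first = if f zero then 1 else 0

count-none : ∀ {k} {f : Subset k} → (∀ i → f i ≢ true) → count f ≤ 0
count-none {zero} _ = z≤n
count-none {suc k} {f} none with f zero in fz
... | true = ⊥-elim (none zero fz)
... | false = count-none (λ i → none (suc i))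

∈-tail : ∀ {k} {v a : Fin k} {L} → v ≢ a → v ∈ a ∷ L → v ∈ L
∈-tail v≢a (here v≡a) = ⊥-elim (v≢a v≡a)
∈-tail _ (there v∈L) = v∈L

length≤count : ∀ {k} {f : Subset k} (L : List (Fin k)) → Unique L →
  (∀ v → v ∈ L → f v ≡ true) → length L ≤ count f
length≤count [] _ _ = z≤n
length≤count {f = f} (a ∷ L) (a∉L ∷ unique) L⊆f rewrite count-removeOne f a (L⊆f a (here refl)) =
  s≤s (length≤count L unique (λ v v∈L →
    ∧-intro (L⊆f v (there v∈L)) (allBut-intro (λ v≡a → All.lookup a∉L v∈L (≡-sym v≡a)))))

count≤length : ∀ {k} {f : Subset k} (L : List (Fin k)) → (∀ v → f v ≡ true → v ∈ L) → count f ≤ length L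
count≤length [] f⊆[] = count-none (λ v fv → case f⊆[] v fv of λ ())
count≤length {f = f} (a ∷ L) f⊆aL with f a in fa
... | true rewrite count-removeOne f a fa = s≤s (count≤length L (λ v rv →
        let (fv , v≢a) = ∧-elim {f v} rv in ∈-tail (allBut-elim v≢a) (f⊆aL v fv)))
... | false = m≤n⇒m≤1+n (count≤length L (λ v fv →
        ∈-tail (λ { refl → true≠false fv fa }) (f⊆aL v fv)))

count-< : ∀ {k} {f g : Subset k} {j} → f ⊆ g → g j ≡ true → f j ≢ true → count f < count g
count-< {f = f} {g} {j} f⊆g gj ¬fj rewrite count-removeOne g j gj =
  s≤s (count-mono (λ v fv → ∧-intro (f⊆g v fv) (allBut-intro (λ { refl → ¬fj fv }))))

count≤0 : ∀ {k} {f : Subset k} → count f ≤ 0 → ∀ i → f i ≢ true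
count≤0 {f = f} none i fi =
  <⇒≱ (length≤count (i ∷ []) ([] ∷ []) (λ { _ (here refl) → fi })) none

outside : ∀ {k} {f : Subset k} (L : List (Fin k)) → length L < count f → ∃ λ z → f z ≡ true × z ∉ L
outside {f = f} L L<f with any? (λ z → (f z B.≟ true) ×-dec ¬? (z ∈? L))
... | yes found = found
... | no none = ⊥-elim (<⇒≱ L<f (count≤length L inL))
  where
  inL : ∀ v → f v ≡ true → v ∈ L
  inL v fv with v ∈? L
  ... | yes v∈L = v∈L
  ... | no v∉L = ⊥-elim (none (v , fv , v∉L))

data Last {A : Set} : List A → A → Set where
  last-one  : ∀ {x} → Last (x ∷ []) x
  last-cons : ∀ {x y ys z} → Last (y ∷ ys) z → Last (x ∷ y ∷ ys) z

Last-∈ : ∀ {A : Set} {L} {z : A} → Last L z → z ∈ L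
Last-∈ last-one = here refl
Last-∈ (last-cons l) = there (Last-∈ l)

Last-snoc : ∀ {A : Set} (L : List A) (x y : A) → Last (x ∷ L ++ y ∷ []) y
Last-snoc [] x y = last-cons last-one
Last-snoc (z ∷ L) x y = last-cons (Last-snoc L z y)

Unique-snoc : ∀ {A : Set} {L : List A} {y} → Unique L → y ∉ L → Unique (L ++ y ∷ [])
Unique-snoc unique y∉L = Unique.++⁺ unique ([] ∷ []) (λ { (y∈L , here refl) → y∉L y∈L })

module Walks {n : ℕ} (G : Graph n) where

  edge-sym : ∀ {u v} → E G u v ≡ true → E G v u ≡ true
  edge-sym {u} {v} e = trans (Graph.sym G v u) e

  edge-≢ : ∀ {u v} → E G u v ≡ true → u ≢ v
  edge-≢ {u} e refl = true≠false e (irrefl G u)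

  reach-start : ∀ {S u v} → Reach G S u v → S u ≡ true
  reach-start (here su) = su
  reach-start (step su _ _) = su

  reach-end : ∀ {S u v} → Reach G S u v → S v ≡ true
  reach-end (here sv) = sv
  reach-end (step _ _ r) = reach-end r

  reach-mono : ∀ {S S' u v} → S ⊆ S' → Reach G S u v → Reach G S' u v
  reach-mono S⊆S' (here su) = here (S⊆S' _ su)
  reach-mono S⊆S' (step su e r) = step (S⊆S' _ su) e (reach-mono S⊆S' r)

  reach-snoc : ∀ {S u v w} → Reach G S u v → E G v w ≡ true → S w ≡ true → Reach G S u w
  reach-snoc (here sv) e sw = step sv e (here sw)
  reach-snoc (step su e' r) e sw = step su e' (reach-snoc r e sw)

  reach-trans : ∀ {S u v w} → Reach G S u v → Reach G S v w → Reach G S u w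
  reach-trans (here _) r = r
  reach-trans (step su e r) r' = step su e (reach-trans r r')

  reach-sym : ∀ {S u v} → Reach G S u v → Reach G S v u
  reach-sym (here sv) = here sv
  reach-sym (step su e r) = reach-snoc (reach-sym r) (edge-sym e) su

  walk-mono : ∀ {S S' L} → S ⊆ S' → IsWalk G S L → IsWalk G S' L
  walk-mono S⊆S' (one sv) = one (S⊆S' _ sv)
  walk-mono S⊆S' (cons sv e w) = cons (S⊆S' _ sv) e (walk-mono S⊆S' w)

  walk-∈ : ∀ {S L v} → IsWalk G S L → v ∈ L → S v ≡ true
  walk-∈ (one sv) (here refl) = sv
  walk-∈ (cons sv _ _) (here refl) = sv
  walk-∈ (cons _ _ w) (there v∈L) = walk-∈ w v∈L

  walk-snoc : ∀ {S L u y} → IsWalk G S L → Last L u → E G u y ≡ true → S y ≡ true →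
    IsWalk G S (L ++ y ∷ [])
  walk-snoc (one su) last-one e sy = cons su e (one sy)
  walk-snoc (cons sv e' w) (last-cons l) e sy = cons sv e' (walk-snoc w l e sy)

  walk-reach : ∀ {S S' L a b} → IsWalk G S L → a ∈ L → b ∈ L → (∀ v → v ∈ L → S' v ≡ true) →
    Reach G S' a b
  walk-reach {L = []} _ () _ _
  walk-reach {L = _ ∷ _} w a∈L b∈L L⊆S' = reach-trans (reach-sym (from-head w a∈L L⊆S')) (from-head w b∈L L⊆S')
    where
    from-head : ∀ {S S' h L b} → IsWalk G S (h ∷ L) → b ∈ h ∷ L →
      (∀ v → v ∈ h ∷ L → S' v ≡ true) → Reach G S' h b
    from-head _ (here refl) L⊆S' = here (L⊆S' _ (here refl))
    from-head (cons _ e w) (there b∈L) L⊆S' =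
      step (L⊆S' _ (here refl)) e (from-head w b∈L (λ v v∈L → L⊆S' v (there v∈L)))

  PathFrom : Subset n → Fin n → Fin n → Set
  PathFrom S a u = Σ (List (Fin n)) λ rest →
    IsWalk G S (a ∷ rest) × Unique (a ∷ rest) × Last (a ∷ rest) u

  path-suffix : ∀ {S} (L : List (Fin n)) {a u} → a ∈ L → IsWalk G S L → Unique L → Last L u →
    PathFrom S a u
  path-suffix (_ ∷ L) (here refl) w unique l = L , w , unique , l
  path-suffix (_ ∷ y ∷ L) (there a∈L) (cons _ _ w) (_ ∷ unique) (last-cons l) =
    path-suffix (y ∷ L) a∈L w unique l

  -- every walk contains a path: shortcut the walk whenever it revisits a vertex
  reach⇒path : ∀ {S a u} → Reach G S a u → PathFrom S a u
  reach⇒path (here sa) = [] , one sa , [] ∷ [] , last-one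
  reach⇒path {a = a} (step {w = w} sa e r) with reach⇒path r
  ... | rest , walk , unique , l with a ∈? (w ∷ rest)
  ...   | yes a∈P = path-suffix (w ∷ rest) a∈P walk unique l
  ...   | no a∉P = w ∷ rest , cons sa e walk , ¬Any⇒All¬ (w ∷ rest) a∉P ∷ unique , last-cons l

  interior : ∀ {S h rest x l} → IsWalk G S (h ∷ rest) → Unique (h ∷ rest) → x ∈ h ∷ rest →
    x ≢ h → Last (h ∷ rest) l → x ≢ l →
    Σ (Fin n) λ p → Σ (Fin n) λ q → p ∈ h ∷ rest × q ∈ h ∷ rest × q ≢ p ×
      E G x p ≡ true × E G x q ≡ true
  interior _ _ (here refl) x≢h _ _ = ⊥-elim (x≢h refl)
  interior {rest = b ∷ rest} {x} (cons _ ehb walk) (_ ∷ unique) (there x∈P) x≢h (last-cons l) x≢l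
    with x F.≟ b
  interior {rest = b ∷ []} _ _ _ _ (last-cons last-one) x≢l | yes refl = ⊥-elim (x≢l refl)
  interior {h = h} {b ∷ c ∷ rest} (cons _ ehb (cons _ ebc _)) ((_ ∷ h≢c ∷ _) ∷ _) _ _ _ _ | yes refl =
    h , c , here refl , there (there (here refl)) , (λ c≡h → h≢c (≡-sym c≡h)) , edge-sym ehb , ebc
  ... | no x≢b with interior walk unique x∈P x≢b l x≢l
  ...   | p , q , p∈P , q∈P , q≢p , exp , exq = p , q , there p∈P , there q∈P , q≢p , exp , exq

  path-length≤ : ∀ {L : List (Fin n)} → Unique L → length L ≤ n
  path-length≤ {L} unique = ≤-trans (length≤count {f = full} L unique (λ _ _ → refl)) (count-≤ full)

  Closed : Subset n → Fin n → List (Fin n) → Set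
  Closed X z P = ∀ y → X y ≡ true → E G z y ≡ true → y ∈ P

  MaximalPath : Subset n → Set
  MaximalPath X = Σ (Fin n) λ h → Σ (List (Fin n)) λ rest → Σ (Fin n) λ l →
    IsWalk G X (h ∷ rest) × Unique (h ∷ rest) × Last (h ∷ rest) l ×
    Closed X h (h ∷ rest) × Closed X l (h ∷ rest)

  private
    Extension : Subset n → Fin n → List (Fin n) → Set
    Extension X z P = ∃ λ y → X y ≡ true × E G z y ≡ true × y ∉ P

    extension? : ∀ X z P → Dec (Extension X z P)
    extension? X z P = any? (λ y → (X y B.≟ true) ×-dec (E G z y B.≟ true) ×-dec ¬? (y ∈? P))

    closed : ∀ {X z P} → ¬ Extension X z P → Closed X z P
    closed {P = P} none y Xy ezy with y ∈? P
    ... | yes y∈P = y∈P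
    ... | no y∉P = ⊥-elim (none (y , Xy , ezy , y∉P))

    -- extend greedily at the head, then at the tail; since a path has at most n
    -- vertices, the fuel invariant guarantees termination
    grow : (X : Subset n) (fuel : ℕ) (h : Fin n) (rest : List (Fin n)) (l : Fin n) →
      IsWalk G X (h ∷ rest) → Unique (h ∷ rest) → Last (h ∷ rest) l →
      n < length (h ∷ rest) + fuel → MaximalPath X
    grow X zero h rest l walk unique last n<len =
      ⊥-elim (<⇒≱ (subst (n <_) (+-identityʳ _) n<len) (path-length≤ unique))
    grow X (suc fuel) h rest l walk unique last n<len with extension? X h (h ∷ rest)
    ... | yes (y , Xy , ehy , y∉P) =
      grow X fuel y (h ∷ rest) l (cons Xy (edge-sym ehy) walk) (¬Any⇒All¬ _ y∉P ∷ unique)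
        (last-cons last) (subst (n <_) (+-suc _ fuel) n<len)
    ... | no head-closed with extension? X l (h ∷ rest)
    ...   | yes (y , Xy , ely , y∉P) =
      grow X fuel h (rest ++ y ∷ []) y (walk-snoc walk last ely Xy) (Unique-snoc unique y∉P)
        (Last-snoc rest h y) (subst (n <_) longer n<len)
      where
      longer : length (h ∷ rest) + suc fuel ≡ length (h ∷ rest ++ y ∷ []) + fuel
      longer = cong suc (≡-sym (trans (cong (_+ fuel) (length-++ rest)) (+-assoc (length rest) 1 fuel)))
    ...   | no tail-closed = h , rest , l , walk , unique , last , closed head-closed , closed tail-closed

  maximal-path : ∀ {X x} → X x ≡ true → MaximalPath X
  maximal-path {X} {x} x∈X = grow X n x [] x (one x∈X) ([] ∷ []) last-one ≤-refl

-- Separation by edges in an acyclic graph, and the Helly property of subtrees.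

module Forests {n : ℕ} (G : Graph n) (acyclic : ¬ HasCycle G) where
  open Walks G

  SideOf : Fin n → Fin n → Fin n → Set
  SideOf a b v = Reach G (allBut b) a v

  -- a neighbour u ≠ a of b is not on the a-side of ab: the path would close a cycle
  no-detour : ∀ {a b u} → E G a b ≡ true → E G u b ≡ true → u ≢ a → ¬ SideOf a b u
  no-detour {a} {b} {u} eab eub u≢a r with reach⇒path r
  ... | [] , _ , _ , last-one = u≢a refl
  ... | (p ∷ ps) , walk , unique , l =
    acyclic ((p ∷ ps) , a , b ,
             walk-snoc (walk-mono (λ _ _ → refl) walk) l eub refl ,
             Unique-snoc unique (λ b∈P → allBut-elim (walk-∈ walk b∈P) refl) ,
             s≤s z≤n , edge-sym eab)

  leave-side : ∀ {S a b s t} → E G a b ≡ true → Reach G S s t → SideOf a b s →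
    SideOf a b t ⊎ (S a ≡ true × S b ≡ true)
  leave-side _ (here _) as = inj₁ as
  leave-side {b = b} eab (step {w = w} _ e r) as with w F.≟ b
  ... | no w≢b = leave-side eab r (reach-snoc as e (allBut-intro w≢b))
  leave-side {a = a} eab (step {u = s} su e r) as | yes refl with s F.≟ a
  ...   | yes refl = inj₂ (su , reach-start r)
  ...   | no s≢a = ⊥-elim (no-detour eab e s≢a as)

  sides-disjoint : ∀ {a b t} → E G a b ≡ true → SideOf a b t → SideOf b a t → ⊥
  sides-disjoint eab at bt with leave-side eab (reach-sym bt) at
  ... | inj₁ ab = allBut-elim (reach-end ab) refl
  ... | inj₂ (b∉ , _) = allBut-elim b∉ refl

  edge-separates : ∀ {S a b s t} → E G a b ≡ true → Connected G S → S s ≡ true → S t ≡ true →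
    SideOf a b s → SideOf b a t → S a ≡ true × S b ≡ true
  edge-separates eab conn ss st as bt with leave-side eab (conn _ _ ss st) as
  ... | inj₁ at = ⊥-elim (sides-disjoint eab at bt)
  ... | inj₂ both = both

  side-of : ∀ {a b} → Connected G full → E G a b ≡ true → ∀ v → SideOf a b v ⊎ SideOf b a v
  side-of {a} {b} conn eab v = propagate (conn a v refl refl) (inj₁ (here (allBut-intro (edge-≢ eab))))
    where
    propagate : ∀ {s v} → Reach G full s v → SideOf a b s ⊎ SideOf b a s → SideOf a b v ⊎ SideOf b a v
    propagate (here _) side = side
    propagate (step {w = w} _ e r) (inj₁ as) with w F.≟ b
    ... | yes refl = propagate r (inj₂ (here (allBut-intro (edge-≢ (edge-sym eab)))))
    ... | no w≢b = propagate r (inj₁ (reach-snoc as e (allBut-intro w≢b)))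
    propagate (step {w = w} _ e r) (inj₂ bs) with w F.≟ a
    ... | yes refl = propagate r (inj₁ (here (allBut-intro (edge-≢ eab))))
    ... | no w≢a = propagate r (inj₂ (reach-snoc bs e (allBut-intro w≢a)))

  exit-or-avoid : ∀ {S s c} (X : Subset n) → Reach G S s c → X c ≢ true →
    Reach G (complement X) s c ⊎
    Σ (Fin n) λ u → Σ (Fin n) λ v → X u ≡ true × E G u v ≡ true × Reach G (complement X) v c
  exit-or-avoid X (here _) Xc = inj₁ (here (not-intro Xc))
  exit-or-avoid {s = s} X (step {w = w} _ e r) Xc with exit-or-avoid X r Xc | X s in Xs
  ... | inj₂ exit | _ = inj₂ exit
  ... | inj₁ avoid | true = inj₂ (s , w , Xs , e , avoid)
  ... | inj₁ avoid | false = inj₁ (step (cong not Xs) e avoid)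

  -- Otherwise follow a walk in B
  -- from the intersection to A ∩ B and look at the edge uv by which it last leaves the
  -- intersection; some member C misses v, and wherever A ∩ C lies relative to uv,
  -- edge-separates puts u into A or v into C.
  meets-⋂ : Connected G full → (A B : Subset n) (Bs : List (Subset n)) → Connected G A →
    (∀ C → C ∈ B ∷ Bs → Connected G C) → (∀ C → C ∈ B ∷ Bs → Meets A C) →
    ∀ x → ⋂ (B ∷ Bs) x ≡ true → Meets A (⋂ (B ∷ Bs))
  meets-⋂ conn A B Bs connA connC meetC x x∈X
    with any? (λ v → (A v B.≟ true) ×-dec (⋂ (B ∷ Bs) v B.≟ true))
  ... | yes found = found
  ... | no disjoint = ⊥-elim impossible
    where
    X = ⋂ (B ∷ Bs)
    c = proj₁ (meetC B (here refl))
    Ac = proj₁ (proj₂ (meetC B (here refl)))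
    impossible : ⊥
    impossible with exit-or-avoid X (connC B (here refl) x c (⋂-elim x∈X (here refl))
                                       (proj₂ (proj₂ (meetC B (here refl)))))
                                    (λ Xc → disjoint (c , Ac , Xc))
    ... | inj₁ avoid = not-true (reach-start avoid) x∈X
    ... | inj₂ (u , v , Xu , euv , v→c) with ⋂-missing (not-true (reach-start v→c))
    ...   | C , C∈ , ¬Cv with meetC C C∈
    ...     | b , Ab , Cb with side-of conn euv b
    ...       | inj₁ ub = disjoint (u , proj₁ (edge-separates euv connA Ab Ac ub
                                                (reach-mono avoids-u v→c)) , Xu)
      where
      avoids-u : complement X ⊆ allBut u
      avoids-u w w∉X = allBut-intro (λ { refl → not-true w∉X Xu })
    ...       | inj₂ vb = ¬Cv (proj₂ (edge-separates euv (connC C C∈) (⋂-elim Xu C∈) Cb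
                                    (here (allBut-intro (edge-≢ euv))) vb))

  helly : Connected G full → (A : Subset n) (As : List (Subset n)) →
    (∀ C → C ∈ A ∷ As → Connected G C) → (∀ C C' → C ∈ A ∷ As → C' ∈ A ∷ As → Meets C C') →
    ∃ λ v → ⋂ (A ∷ As) v ≡ true
  helly _ A [] _ meet with meet A A (here refl) (here refl)
  ... | v , Av , _ = v , ⋂-intro (λ { _ (here refl) → Av })
  helly conn A (B ∷ Bs) connC meet
    with helly conn B Bs (λ C C∈ → connC C (there C∈)) (λ C C' C∈ C'∈ → meet C C' (there C∈) (there C'∈))
  ... | x , x∈X with meets-⋂ conn A B Bs (connC A (here refl)) (λ C C∈ → connC C (there C∈))
                         (λ C C∈ → meet A C (here refl) (there C∈)) x x∈X
  ...   | v , Av , Xv = v , ⋂-intro (λ { _ (here refl) → Av ; _ (there C∈) → ⋂-elim Xv C∈ })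

module PathDecomposition {n : ℕ} (T : Graph n) (tree : IsTree T)
  (branching : ∀ v → 2 ≤ deg T v → 4 ≤ deg T v)
  {m : ℕ} (U : Fin m → Subset n)
  (subtrees : ∀ i → IsSubtree T (U i) × MaxDegAtMost 3 T (U i))
  (covers : CoversEdges T U) where

  open Walks T
  open Forests T (proj₂ (proj₂ tree))

  T-connected : Connected T full
  T-connected = proj₁ (proj₂ tree)

  U-connected : ∀ i → Connected T (U i)
  U-connected i = proj₂ (proj₁ (subtrees i))

  meeting : Subset n → Fin m → Bool
  meeting D i = ⌊ meets? (U i) D ⌋

  meeting-elim : ∀ {D i} → meeting D i ≡ true → Meets (U i) D
  meeting-elim {D} {i} = ⌊⌋-elim (meets? (U i) D)

  meeting-intro : ∀ {D i v} → U i v ≡ true → D v ≡ true → meeting D i ≡ true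
  meeting-intro {D} {i} {v} Uiv Dv = ⌊⌋-intro (meets? (U i) D) (v , Uiv , Dv)

  meeting-mono : ∀ {D D'} → D' ⊆ D → meeting D' ⊆ meeting D
  meeting-mono D'⊆D i mi with meeting-elim mi
  ... | v , Uiv , D'v = meeting-intro Uiv (D'⊆D v D'v)

  singleton : ∀ {D} → NonEmpty D → Connected T D → (∀ i → meeting D i ≢ true) → IsSingleton D
  singleton {D} (d , Dd) conn none = d , λ u Du → only (conn u d Du Dd)
    where
    only : ∀ {u} → Reach T D u d → u ≡ d
    only (here _) = refl
    only {u} (step Du e _) with covers u _ e
    ... | i , Uiu , _ = ⊥-elim (none i (meeting-intro Uiu Du))

  component-⊆ : ∀ {D P D'} → IsComponent T (minusList D P) D' → ∀ v → D' v ≡ true → D v ≡ true × v ∉ P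
  component-⊆ {D} (D'⊆ , _) v D'v = minusList-elim {D = D} (D'⊆ v D'v)

  attachment : ∀ {D P D' q} → Connected T D → q ∈ P → (∀ v → v ∈ P → D v ≡ true) →
    IsComponent T (minusList D P) D' →
    Σ (Fin n) λ x → Σ (Fin n) λ y → x ∈ P × D' y ≡ true × E T x y ≡ true
  attachment {D} {P} {D'} {q} conn q∈P P⊆D comp@(_ , (d , D'd) , _ , closed) =
    leave (conn d q (proj₁ (component-⊆ {D} comp d D'd)) (P⊆D q q∈P)) D'd q∈P
    where
    -- follow a walk in D from D' to P until it first leaves D'
    leave : ∀ {s t} → Reach T D s t → D' s ≡ true → t ∈ P →
      Σ (Fin n) λ x → Σ (Fin n) λ y → x ∈ P × D' y ≡ true × E T x y ≡ true
    leave (here _) D's t∈P = ⊥-elim (proj₂ (component-⊆ {D} comp _ D's) t∈P)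
    leave {s} (step {w = w} _ e r) D's t∈P with D' w in D'w
    ... | true = leave r D'w t∈P
    ... | false with w ∈? P
    ...   | yes w∈P = w , s , w∈P , D's , edge-sym e
    ...   | no w∉P = ⊥-elim (true≠false (closed s w D's (minusList-intro {D = D} (reach-start r) w∉P) e) D'w)

  through : ∀ {D P D' x y s} i → IsComponent T (minusList D P) D' → x ∈ P → D' y ≡ true →
    E T x y ≡ true → U i s ≡ true → SideOf x y s → meeting D' i ≡ true → U i x ≡ true × U i y ≡ true
  through {D} {P} {D'} {x} {y} i comp@(_ , _ , D'-connected , _) x∈P D'y exy Uis xs mi
    with meeting-elim mi
  ... | t , Uit , D't = edge-separates exy (U-connected i) Uis Uit xs
    (reach-mono avoids-x (D'-connected y t D'y D't))
    where
    avoids-x : D' ⊆ allBut x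
    avoids-x v D'v = allBut-intro (λ { refl → proj₂ (component-⊆ {D} comp v D'v) x∈P })

  Loses : Subset n → Subset n → Set
  Loses D D' = ∃ λ i → meeting D i ≡ true × meeting D' i ≢ true

  loses-count : ∀ {D D'} → D' ⊆ D → Loses D D' → count (meeting D') < count (meeting D)
  loses-count D'⊆D (_ , mi , ¬m'i) = count-< (meeting-mono D'⊆D) mi ¬m'i

  GoodPath : Subset n → Set
  GoodPath D = Σ (List (Fin n)) λ P → IsPath T D P ×
    (∀ D' → IsComponent T (minusList D P) D' → Loses D D')

  -- if two members meeting D are disjoint, a path of D between them is good: a component
  -- keeping both members would force both to contain the vertex where it attaches to the path
  separating-path : ∀ {D i j} → Connected T D → meeting D i ≡ true → meeting D j ≡ true →
    ¬ Meets (U i) (U j) → GoodPath D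
  separating-path {D} {i} {j} conn mi mj disjoint with meeting-elim mi | meeting-elim mj
  ... | s , Uis , Ds | t , Ujt , Dt with reach⇒path (conn s t Ds Dt)
  ...   | rest , walk , unique , last = s ∷ rest , (walk , unique) , loses
    where
    loses : ∀ D' → IsComponent T (minusList D (s ∷ rest)) D' → Loses D D'
    loses D' comp with meeting D' i B.≟ true | meeting D' j B.≟ true
    ... | no ¬m'i | _ = i , mi , ¬m'i
    ... | yes _ | no ¬m'j = j , mj , ¬m'j
    ... | yes m'i | yes m'j with attachment conn (here refl) (λ v v∈P → walk-∈ walk v∈P) comp
    ...   | x , y , x∈P , D'y , exy = ⊥-elim (disjoint (x , Uix , Ujx))
      where
      P-avoids-y : ∀ v → v ∈ s ∷ rest → allBut y v ≡ true
      P-avoids-y v v∈P = allBut-intro (λ { refl → proj₂ (component-⊆ {D} comp y D'y) v∈P })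
      Uix : U i x ≡ true
      Uix = proj₁ (through i comp x∈P D'y exy Uis (walk-reach walk x∈P (here refl) P-avoids-y) m'i)
      Ujx : U j x ≡ true
      Ujx = proj₁ (through j comp x∈P D'y exy Ujt (walk-reach walk x∈P (Last-∈ last) P-avoids-y) m'j)

  core : Subset n → Subset n
  core D v = D v ∧ ⌊ all? (λ i → (meeting D i B.≟ true) →-dec (U i v B.≟ true)) ⌋

  core-⊆ : ∀ {D} → core D ⊆ D
  core-⊆ {D} v p = proj₁ (∧-elim {D v} p)

  core-member : ∀ {D v i} → core D v ≡ true → meeting D i ≡ true → U i v ≡ true
  core-member {D} {v} {i} p =
    ⌊⌋-elim (all? (λ i → (meeting D i B.≟ true) →-dec (U i v B.≟ true))) (proj₂ (∧-elim {D v} p)) i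

  core-intro : ∀ {D v} → D v ≡ true → (∀ i → meeting D i ≡ true → U i v ≡ true) → core D v ≡ true
  core-intro {D} {v} Dv inside =
    ∧-intro Dv (⌊⌋-intro (all? (λ i → (meeting D i B.≟ true) →-dec (U i v B.≟ true))) inside)

  members : Subset n → List (Subset n)
  members D = map U (filter (λ i → meeting D i B.≟ true) (allFin m))

  members-elim : ∀ {D C} → C ∈ members D → ∃ λ i → meeting D i ≡ true × C ≡ U i
  members-elim {D} C∈ with ∈-map⁻ U {xs = filter (λ i → meeting D i B.≟ true) (allFin m)} C∈
  ... | i , i∈ , refl = i , proj₂ (∈-filter⁻ (λ i → meeting D i B.≟ true) {xs = allFin m} i∈) , refl

  members-intro : ∀ {D i} → meeting D i ≡ true → U i ∈ members D
  members-intro {D} {i} mi = ∈-map⁺ U (∈-filter⁺ (λ i → meeting D i B.≟ true) (∈-allFin i) mi)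

  -- by the Helly property, if the members meeting D pairwise meet then the core is nonempty
  core-nonempty : ∀ {D} → NonEmpty D → Connected T D →
    (∀ i j → meeting D i ≡ true → meeting D j ≡ true → Meets (U i) (U j)) → NonEmpty (core D)
  core-nonempty {D} (d , Dd) conn pairwise = in-core (helly T-connected D (members D) connected meet)
    where
    in-core : (∃ λ v → ⋂ (D ∷ members D) v ≡ true) → NonEmpty (core D)
    in-core (v , v∈⋂) = v , core-intro (⋂-elim v∈⋂ (here refl)) (λ i mi → ⋂-elim v∈⋂ (there (members-intro mi)))
    connected : ∀ C → C ∈ D ∷ members D → Connected T C
    connected _ (here refl) = conn
    connected _ (there C∈) with members-elim C∈
    ... | i , _ , refl = U-connected i
    meet : ∀ C C' → C ∈ D ∷ members D → C' ∈ D ∷ members D → Meets C C'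
    meet _ _ (here refl) (here refl) = d , Dd , Dd
    meet _ _ (here refl) (there C'∈) with members-elim C'∈
    ... | i , mi , refl = let (v , Uiv , Dv) = meeting-elim mi in v , Dv , Uiv
    meet _ _ (there C∈) (here refl) with members-elim C∈
    ... | i , mi , refl = meeting-elim mi
    meet _ _ (there C∈) (there C'∈) with members-elim C∈ | members-elim C'∈
    ... | i , mi , refl | j , mj , refl = pairwise i j mi mj

  -- no vertex x of D has three distinct neighbours lying in every member that meets D:
  -- x would have degree at least 4, and the member covering the edge to a fourth
  -- neighbour would contain all four neighbours of x, exceeding maximum degree 3
  no-claw : ∀ {D x p q y} → D x ≡ true → Unique (p ∷ q ∷ y ∷ []) →
    (∀ w → w ∈ p ∷ q ∷ y ∷ [] → E T x w ≡ true) →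
    (∀ i → meeting D i ≡ true → ∀ w → w ∈ p ∷ q ∷ y ∷ [] → U i w ≡ true) → ⊥
  no-claw {D} {x} {p} {q} {y} Dx unique adjacent inside =
    fourth-neighbour (outside {f = λ w → E T x w ∧ full w} (p ∷ q ∷ y ∷ []) degree≥4)
    where
    degree≥4 : 4 ≤ deg T x
    degree≥4 = branching x (length≤count (p ∷ q ∷ []) (first-two unique)
      (λ { _ (here refl) → ∧-intro (adjacent p (here refl)) refl
         ; _ (there (here refl)) → ∧-intro (adjacent q (there (here refl))) refl }))
      where
      first-two : ∀ {a b c : Fin n} → Unique (a ∷ b ∷ c ∷ []) → Unique (a ∷ b ∷ [])
      first-two ((a≢b ∷ _) ∷ _) = (a≢b ∷ []) ∷ [] ∷ []
    4≰3 : ¬ 4 ≤ 3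
    4≰3 (s≤s (s≤s (s≤s ())))
    fourth-neighbour : (∃ λ z → E T x z ∧ full z ≡ true × z ∉ p ∷ q ∷ y ∷ []) → ⊥
    fourth-neighbour (z , exz , z∉N) with covers x z (proj₁ (∧-elim exz))
    ... | i , Uix , Uiz =
      4≰3 (≤-trans (length≤count (p ∷ q ∷ y ∷ z ∷ []) (Unique-snoc unique z∉N) in-U) (proj₂ (subtrees i) x Uix))
      where
      in-U-N : ∀ w → w ∈ p ∷ q ∷ y ∷ [] → E T x w ∧ U i w ≡ true
      in-U-N w w∈ = ∧-intro (adjacent w w∈) (inside i (meeting-intro Uix Dx) w w∈)
      in-U : ∀ w → w ∈ p ∷ q ∷ y ∷ z ∷ [] → E T x w ∧ U i w ≡ true
      in-U w (here refl) = in-U-N w (here refl)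
      in-U w (there (here refl)) = in-U-N w (there (here refl))
      in-U w (there (there (here refl))) = in-U-N w (there (there (here refl)))
      in-U w (there (there (there (here refl)))) = ∧-intro (proj₁ (∧-elim exz)) Uiz

  -- if the members meeting D pairwise meet, a maximal path of the core of D is good: a
  -- component keeping every member attaches at some x by an edge xy with y in the core,
  -- so x is no end of the path and its two path neighbours together with y form a claw
  core-path : ∀ {D} → NonEmpty D → Connected T D →
    (∀ i j → meeting D i ≡ true → meeting D j ≡ true → Meets (U i) (U j)) → GoodPath D
  core-path {D} nonempty conn pairwise with maximal-path (proj₂ (core-nonempty nonempty conn pairwise))
  ... | h , rest , l , walk , unique , last , h-closed , l-closed =
    h ∷ rest , (walk-mono core-⊆ walk , unique) , loses
    where
    loses : ∀ D' → IsComponent T (minusList D (h ∷ rest)) D' → Loses D D'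
    loses D' comp with any? (λ i → (meeting D i B.≟ true) ×-dec ¬? (meeting D' i B.≟ true))
    ... | yes lost = lost
    ... | no keeps with attachment conn (here refl) (λ v v∈P → core-⊆ v (walk-∈ walk v∈P)) comp
    ...   | x , y , x∈P , D'y , exy = claw-at-x
      where
      kept : ∀ i → meeting D i ≡ true → meeting D' i ≡ true
      kept i mi with meeting D' i B.≟ true
      ... | yes m'i = m'i
      ... | no ¬m'i = ⊥-elim (keeps (i , mi , ¬m'i))
      y∉P : y ∉ h ∷ rest
      y∉P = proj₂ (component-⊆ {D} comp y D'y)
      in-core : ∀ {v} → v ∈ h ∷ rest → core D v ≡ true
      in-core v∈P = walk-∈ walk v∈P
      y∈core : core D y ≡ true
      y∈core = core-intro (proj₁ (component-⊆ {D} comp y D'y)) (λ i mi →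
        proj₂ (through i comp x∈P D'y exy (core-member (in-core x∈P) mi)
                 (here (allBut-intro (edge-≢ exy))) (kept i mi)))
      claw-at-x : Loses D D'
      claw-at-x with x F.≟ h | x F.≟ l
      ... | yes x≡h | _ = ⊥-elim (y∉P (h-closed y y∈core (subst (λ z → E T z y ≡ true) x≡h exy)))
      ... | no _ | yes x≡l = ⊥-elim (y∉P (l-closed y y∈core (subst (λ z → E T z y ≡ true) x≡l exy)))
      ... | no x≢h | no x≢l with interior walk unique x∈P x≢h last x≢l
      ...   | p , q , p∈P , q∈P , q≢p , exp , exq =
        ⊥-elim (no-claw (core-⊆ x (in-core x∈P)) distinct adjacent inside)
        where
        distinct : Unique (p ∷ q ∷ y ∷ [])
        distinct = ((λ p≡q → q≢p (≡-sym p≡q)) ∷ (λ { refl → y∉P p∈P }) ∷ [])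
                 ∷ ((λ { refl → y∉P q∈P }) ∷ []) ∷ [] ∷ []
        adjacent : ∀ w → w ∈ p ∷ q ∷ y ∷ [] → E T x w ≡ true
        adjacent _ (here refl) = exp
        adjacent _ (there (here refl)) = exq
        adjacent _ (there (there (here refl))) = exy
        inside : ∀ i → meeting D i ≡ true → ∀ w → w ∈ p ∷ q ∷ y ∷ [] → U i w ≡ true
        inside i mi _ (here refl) = core-member (in-core p∈P) mi
        inside i mi _ (there (here refl)) = core-member (in-core q∈P) mi
        inside i mi _ (there (there (here refl))) = core-member y∈core mi

  good-path : ∀ {D} → NonEmpty D → Connected T D → GoodPath D
  good-path {D} nonempty conn with any? (λ i → any? (λ j →
    (meeting D i B.≟ true) ×-dec (meeting D j B.≟ true) ×-dec ¬? (meets? (U i) (U j))))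
  ... | yes (i , j , mi , mj , disjoint) = separating-path conn mi mj disjoint
  ... | no none = core-path nonempty conn pairwise
    where
    pairwise : ∀ i j → meeting D i ≡ true → meeting D j ≡ true → Meets (U i) (U j)
    pairwise i j mi mj with meets? (U i) (U j)
    ... | yes meet = meet
    ... | no disjoint = ⊥-elim (none (i , j , mi , mj , disjoint))

  pathwidth-bound : ∀ k D → NonEmpty D → Connected T D → count (meeting D) ≤ k → TreePW≤ T k D
  pathwidth-bound zero D nonempty conn none = singleton nonempty conn (count≤0 none)
  pathwidth-bound (suc k) D nonempty conn count≤ with good-path nonempty conn
  ... | P , path , loses = inj₂ (P , path , λ D' comp@(_ , nonempty' , conn' , _) →
    pathwidth-bound k D' nonempty' conn'
      (≤-pred (≤-trans (loses-count (λ v D'v → proj₁ (component-⊆ {D} comp v D'v)) (loses D' comp)) count≤)))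

mainTheorem18 : (n : ℕ) (T : Graph n) → IsTree T →
    (∀ v → 2 ≤ deg T v → 4 ≤ deg T v) →
    (m : ℕ) (U : Fin m → Subset n) →
    (∀ i → IsSubtree T (U i) × MaxDegAtMost 3 T (U i)) →
    CoversEdges T U →
    Pathwidth≤ T m
mainTheorem18 n T tree branching m U subtrees covers =
  pathwidth-bound m full (proj₁ tree) (proj₁ (proj₂ tree)) (count-≤ _)
  where open PathDecomposition T tree branching U subtrees covers
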